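{- Let $R$ be an orthogonal term rewriting system over a signature $\Sigma$, and let $\Sigma' \subseteq \Sigma$, such that every rule $\ell \to r$ of $R$ is of one of the following two shapes: (i) $\ell \to r$ is variable preserving (every variable occurring in $\ell$ occurs exactly once in $r$), and neither $\ell$ nor $r$ contains symbols from $\Sigma'$; (ii) the root symbol of $\ell$ is in $\Sigma'$, and for every occurrence in $r$ of a symbol from $\Sigma'$, the arguments of this occurrence do not contain defined symbols. Then for every basic term $t$, any two reductions of $t$ to normal form have the same length (number of rewrite steps).
   Context: Terms are first-order terms over $\Sigma$ and a set of variables; orthogonal means left-linear with no overlaps between left-hand sides, as standard. A symbol is a defined symbol if it occurs as the root symbol of the left-hand side of some rule of $R$. A term is basic if its root symbol is a defined symbol and this root is the only occurrence of a defined symbol in the term. A reduction is a finite sequence of one-step rewrites $\to_R$; a reduction of $t$ to normal form is a reduction starting in $t$ and ending in a term to which no rule of $R$ applies. -}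

module Defs where

open import Data.Nat using (ℕ; zero; suc; _+_; _≤_)
open import Data.Nat.Properties using (_≟_)
open import Data.Fin using (Fin)
open import Data.Vec using (Vec; []; _∷_; lookup; _[_]≔_)
open import Data.Product using (Σ; _×_; _,_; ∃)
open import Relation.Nullary using (¬_; yes; no)
open import Relation.Binary.PropositionalEquality using (_≡_)

data Term {F : Set} (ar : F → ℕ) : Set where
  var : ℕ → Term ar
  fun : (f : F) → Vec (Term ar) (ar f) → Term ar

module _ {F : Set} {ar : F → ℕ} where

  Subst : Set
  Subst = ℕ → Term ar

  mutual
    _⟨_⟩ : Term ar → Subst → Term ar
    var x ⟨ σ ⟩ = σ x
    fun f ts ⟨ σ ⟩ = fun f (ts ⟨ σ ⟩*)

    _⟨_⟩* : ∀ {n} → Vec (Term ar) n → Subst → Vec (Term ar) n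
    [] ⟨ σ ⟩* = []
    (t ∷ ts) ⟨ σ ⟩* = (t ⟨ σ ⟩) ∷ (ts ⟨ σ ⟩*)

  mutual
    occ : ℕ → Term ar → ℕ
    occ x (var y) with x ≟ y
    ... | yes _ = 1
    ... | no _ = 0
    occ x (fun f ts) = occs x ts

    occs : ∀ {n} → ℕ → Vec (Term ar) n → ℕ
    occs x [] = 0
    occs x (t ∷ ts) = occ x t + occs x ts

  data _⊴_ : Term ar → Term ar → Set where
    here  : ∀ {t} → t ⊴ t
    there : ∀ {s f} {ts : Vec (Term ar) (ar f)} (i : Fin (ar f)) →
            s ⊴ lookup ts i → s ⊴ fun f ts

  data _◁_ : Term ar → Term ar → Set where
    sub : ∀ {s f} {ts : Vec (Term ar) (ar f)} (i : Fin (ar f)) →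
          s ⊴ lookup ts i → s ◁ fun f ts

  Occurs : F → Term ar → Set
  Occurs f t = Σ (Vec (Term ar) (ar f)) λ ts → fun f ts ⊴ t

  ContainsFrom : (F → Set) → Term ar → Set
  ContainsFrom P t = Σ F λ f → P f × Occurs f t

  IsFun : Term ar → Set
  IsFun t = Σ F λ f → Σ (Vec (Term ar) (ar f)) λ ts → t ≡ fun f ts

  -- A TRS is given as a relation R ℓ r : "ℓ → r is a rule of R".
  TRS : Set₁
  TRS = Term ar → Term ar → Set

  WellFormed : TRS → Set
  WellFormed R = ∀ ℓ r → R ℓ r →
    IsFun ℓ × (∀ x → 1 ≤ occ x r → 1 ≤ occ x ℓ)

  data Step (R : TRS) : Term ar → Term ar → Set where
    root : ∀ {ℓ r} (σ : Subst) → R ℓ r → Step R (ℓ ⟨ σ ⟩) (r ⟨ σ ⟩)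
    cong : ∀ {f u} {ts : Vec (Term ar) (ar f)} (i : Fin (ar f)) →
           Step R (lookup ts i) u → Step R (fun f ts) (fun f (ts [ i ]≔ u))

  data Steps (R : TRS) : ℕ → Term ar → Term ar → Set where
    done : ∀ {t} → Steps R 0 t t
    step : ∀ {n t u v} → Step R t u → Steps R n u v → Steps R (suc n) t v

  NormalForm : TRS → Term ar → Set
  NormalForm R t = ∀ u → ¬ Step R t u

  LeftLinear : TRS → Set
  LeftLinear R = ∀ ℓ r → R ℓ r → ∀ x → occ x ℓ ≤ 1

  -- no critical overlaps: two left-hand sides (renamed apart, i.e. with
  -- independent substitutions) do not unify at the root unless they are
  -- the same rule, and a lhs never unifies with a non-variable proper
  -- subterm of a lhs.
  NonOverlapping : TRS → Set
  NonOverlapping R =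
    (∀ ℓ₁ r₁ ℓ₂ r₂ (σ τ : Subst) → R ℓ₁ r₁ → R ℓ₂ r₂ →
       ℓ₁ ⟨ σ ⟩ ≡ ℓ₂ ⟨ τ ⟩ → ℓ₁ ≡ ℓ₂ × r₁ ≡ r₂)
    × (∀ ℓ₁ r₁ ℓ₂ r₂ s (σ τ : Subst) → R ℓ₁ r₁ → R ℓ₂ r₂ →
       s ◁ ℓ₁ → IsFun s → ¬ (s ⟨ σ ⟩ ≡ ℓ₂ ⟨ τ ⟩))

  Orthogonal : TRS → Set
  Orthogonal R = LeftLinear R × NonOverlapping R

  Defined : TRS → F → Set
  Defined R f = Σ (Vec (Term ar) (ar f)) λ ts → Σ (Term ar) λ r → R (fun f ts) r

  Basic : TRS → Term ar → Set
  Basic R t = Σ F λ f → Σ (Vec (Term ar) (ar f)) λ ts →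
    t ≡ fun f ts × Defined R f ×
    (∀ (i : Fin (ar f)) g → Occurs g (lookup ts i) → ¬ Defined R g)

  VariablePreserving : Term ar → Term ar → Set
  VariablePreserving ℓ r = ∀ x → 1 ≤ occ x ℓ → occ x r ≡ 1

  ShapeI : (F → Set) → Term ar → Term ar → Set
  ShapeI Σ' ℓ r = VariablePreserving ℓ r × ¬ ContainsFrom Σ' ℓ × ¬ ContainsFrom Σ' r

  ShapeII : TRS → (F → Set) → Term ar → Term ar → Set
  ShapeII R Σ' ℓ r =
    (Σ F λ f → Σ (Vec (Term ar) (ar f)) λ ts → ℓ ≡ fun f ts × Σ' f)
    × (∀ g (us : Vec (Term ar) (ar g)) → fun g us ⊴ r → Σ' g →
         ∀ (i : Fin (ar g)) h → Occurs h (lookup us i) → ¬ Defined R h)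

-- Call a term guarded if every argument of every Σ'-symbol in it is free of
-- defined symbols. Basic terms are guarded, and rewriting preserves this:
-- shape-(i) rules contain no Σ'-symbols, and shape-(ii) right-hand sides
-- only put defined-symbol-free terms below Σ'-symbols. On guarded terms the
-- one-step relation has the diamond property: two distinct steps can each be
-- completed by exactly one more step to a common term. Orthogonality reduces
-- this to a root step against a step inside the substitution of its redex; a
-- shape-(i) rule copies that position exactly once into its right-hand side,
-- and for a shape-(ii) rule the inner step cannot exist, because the
-- arguments of its Σ'-root contain no redex. By the classical
-- random-descent argument, all reductions to normal form then have equal
-- length.
module Submission where

open import Defs
open import Data.Nat using (ℕ; zero; suc; _+_; _≤_; z≤n; s≤s)
open import Data.Nat.Properties
  using (_≟_; 1+n≰n; suc-injective; m≤m+n; m≤n+m; ≤-trans; +-comm; +-identityʳ; n≤0⇒n≡0; m+n≡0⇒n≡0)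
open import Data.Fin using (Fin; zero; suc)
open import Data.Vec using (Vec; []; _∷_; lookup; _[_]≔_)
open import Data.Vec.Properties using (∷-injectiveˡ; ∷-injectiveʳ)
open import Data.Product using (Σ; ∃; _×_; _,_; proj₁; proj₂)
open import Data.Sum using (_⊎_; inj₁; inj₂)
open import Data.Empty using (⊥-elim)
open import Relation.Nullary using (¬_; yes; no)
open import Relation.Binary.PropositionalEquality
  using (_≡_; refl; sym; trans; cong₂; subst) renaming (cong to ap)

module RandomDescent {A : Set} (_⟶_ : A → A → Set) (Inv : A → Set)
  (⟶-preserves-Inv : ∀ {a b} → Inv a → a ⟶ b → Inv b)
  (diamond : ∀ {a b c} → Inv a → a ⟶ b → a ⟶ c →
             b ≡ c ⊎ ∃ λ d → b ⟶ d × c ⟶ d) where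

  data _⟶[_]_ : A → ℕ → A → Set where
    done : ∀ {a} → a ⟶[ 0 ] a
    step : ∀ {n a b c} → a ⟶ b → b ⟶[ n ] c → a ⟶[ suc n ] c

  Normal : A → Set
  Normal a = ∀ b → ¬ a ⟶ b

  completion-has-same-length : ∀ m {a b} → Inv a → a ⟶[ m ] b → Normal b →
    ∀ {n c} → a ⟶[ n ] c → Σ ℕ λ k → Σ A λ d → c ⟶[ k ] d × Normal d × n + k ≡ m
  completion-has-same-length m       inv a⟶b nb done = m , _ , a⟶b , nb , refl
  completion-has-same-length zero    inv done nb (step s _) = ⊥-elim (nb _ s)
  completion-has-same-length (suc m) inv (step s₁ r₁) nb (step s₂ r₂)
    with diamond inv s₁ s₂
  ... | inj₁ refl with completion-has-same-length m (⟶-preserves-Inv inv s₁) r₁ nb r₂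
  ...   | k , d , c⟶d , nd , n+k≡m = k , d , c⟶d , nd , ap suc n+k≡m
  completion-has-same-length (suc m) inv (step s₁ r₁) nb (step s₂ r₂) | inj₂ (e , b⟶e , c⟶e)
    with completion-has-same-length m (⟶-preserves-Inv inv s₁) r₁ nb (step b⟶e done)
  ... | k₁ , d₁ , e⟶d₁ , nd₁ , 1+k₁≡m
    with completion-has-same-length m (⟶-preserves-Inv inv s₂)
           (subst (λ j → _ ⟶[ j ] d₁) 1+k₁≡m (step c⟶e e⟶d₁)) nd₁ r₂
  ... | k , d , c⟶d , nd , n+k≡m = k , d , c⟶d , nd , ap suc n+k≡m

  normal-forms-have-equal-distance : ∀ {m n a b c} → Inv a →
    a ⟶[ m ] b → Normal b → a ⟶[ n ] c → Normal c → m ≡ n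
  normal-forms-have-equal-distance {m} {n} inv a⟶b nb a⟶c nc
    with completion-has-same-length m inv a⟶b nb a⟶c
  ... | zero  , _ , done     , _ , n+0≡m = trans (sym n+0≡m) (+-identityʳ n)
  ... | suc _ , _ , step s _ , _ , _     = ⊥-elim (nc _ s)

≡suc⇒1≤ : ∀ {n k} → n ≡ suc k → 1 ≤ n
≡suc⇒1≤ refl = s≤s z≤n

1≤m⇒m+n≤1⇒n≡0 : ∀ {m n} → 1 ≤ m → m + n ≤ 1 → n ≡ 0
1≤m⇒m+n≤1⇒n≡0 {suc m} _ (s≤s m+n≤0) = m+n≡0⇒n≡0 m (n≤0⇒n≡0 m+n≤0)

1≤n⇒m+n≤1⇒m≡0 : ∀ {m n} → 1 ≤ n → m + n ≤ 1 → m ≡ 0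
1≤n⇒m+n≤1⇒m≡0 {m} {n} 1≤n m+n≤1 =
  1≤m⇒m+n≤1⇒n≡0 1≤n (subst (_≤ 1) (+-comm m n) m+n≤1)

module Terms {F : Set} {ar : F → ℕ} where

  -- A structural copy of _⊴_ that descends into vectors one cons at a time,
  -- matching the recursion of substitution and of _⟶ᵥ_ below.
  infix 4 _⊑_ _⊑ᵥ_
  data _⊑_ : Term ar → Term ar → Set
  data _⊑ᵥ_ : ∀ {n} → Term ar → Vec (Term ar) n → Set
  data _⊑_ where
    here  : ∀ {t} → t ⊑ t
    there : ∀ {s f} {ts : Vec (Term ar) (ar f)} → s ⊑ᵥ ts → s ⊑ fun f ts
  data _⊑ᵥ_ where
    head : ∀ {n s t} {ts : Vec (Term ar) n} → s ⊑ t → s ⊑ᵥ t ∷ ts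
    tail : ∀ {n s t} {ts : Vec (Term ar) n} → s ⊑ᵥ ts → s ⊑ᵥ t ∷ ts

  mutual
    ⊑⇒⊴ : ∀ {s t} → s ⊑ t → s ⊴ t
    ⊑⇒⊴ here = here
    ⊑⇒⊴ (there p) with ⊑ᵥ⇒⊴-lookup p
    ... | i , q = there i q

    ⊑ᵥ⇒⊴-lookup : ∀ {n s} {ts : Vec (Term ar) n} → s ⊑ᵥ ts →
                  Σ (Fin n) λ i → s ⊴ lookup ts i
    ⊑ᵥ⇒⊴-lookup (head p) = zero , ⊑⇒⊴ p
    ⊑ᵥ⇒⊴-lookup (tail p) with ⊑ᵥ⇒⊴-lookup p
    ... | i , q = suc i , q

  ⊑ᵥ⇒◁ : ∀ {s f} {ts : Vec (Term ar) (ar f)} → s ⊑ᵥ ts → s ◁ fun f ts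
  ⊑ᵥ⇒◁ p with ⊑ᵥ⇒⊴-lookup p
  ... | i , q = sub i q

  mutual
    ⊑-trans : ∀ {s t u} → s ⊑ t → t ⊑ u → s ⊑ u
    ⊑-trans p here      = p
    ⊑-trans p (there q) = there (⊑-⊑ᵥ-trans p q)

    ⊑-⊑ᵥ-trans : ∀ {n s t} {us : Vec (Term ar) n} → s ⊑ t → t ⊑ᵥ us → s ⊑ᵥ us
    ⊑-⊑ᵥ-trans p (head q) = head (⊑-trans p q)
    ⊑-⊑ᵥ-trans p (tail q) = tail (⊑-⊑ᵥ-trans p q)

  mutual
    occ-⊑ : ∀ {s t} x → s ⊑ t → 1 ≤ occ x s → 1 ≤ occ x t
    occ-⊑ x here      o = o
    occ-⊑ x (there p) o = occ-⊑ᵥ x p o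

    occ-⊑ᵥ : ∀ {n s} {ts : Vec (Term ar) n} x → s ⊑ᵥ ts → 1 ≤ occ x s → 1 ≤ occs x ts
    occ-⊑ᵥ x (head p) o = ≤-trans (occ-⊑ x p o) (m≤m+n _ _)
    occ-⊑ᵥ x (tail p) o = ≤-trans (occ-⊑ᵥ x p o) (m≤n+m _ _)

  occ-var-self : ∀ x → occ {ar = ar} x (var x) ≡ 1
  occ-var-self x with x ≟ x
  ... | yes _ = refl
  ... | no x≢x = ⊥-elim (x≢x refl)

  1≤occ-var-self : ∀ x → 1 ≤ occ {ar = ar} x (var x)
  1≤occ-var-self x = ≡suc⇒1≤ (occ-var-self x)


  _[_↦_] : Subst → ℕ → Term ar → Subst
  (σ [ x ↦ u ]) y with x ≟ y
  ... | yes _ = u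
  ... | no _  = σ y

  [↦]-self : ∀ σ x u → (σ [ x ↦ u ]) x ≡ u
  [↦]-self σ x u with x ≟ x
  ... | yes _ = refl
  ... | no x≢x = ⊥-elim (x≢x refl)

  mutual
    ⟨⟩-cong-vars : ∀ t {σ τ : Subst} → (∀ y → 1 ≤ occ y t → σ y ≡ τ y) →
                   t ⟨ σ ⟩ ≡ t ⟨ τ ⟩
    ⟨⟩-cong-vars (var x)    h = h x (1≤occ-var-self x)
    ⟨⟩-cong-vars (fun f ts) h = ap (fun f) (⟨⟩*-cong-vars ts h)

    ⟨⟩*-cong-vars : ∀ {n} (ts : Vec (Term ar) n) {σ τ : Subst} →
                    (∀ y → 1 ≤ occs y ts → σ y ≡ τ y) → ts ⟨ σ ⟩* ≡ ts ⟨ τ ⟩*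
    ⟨⟩*-cong-vars []       h = refl
    ⟨⟩*-cong-vars (t ∷ ts) h =
      cong₂ _∷_ (⟨⟩-cong-vars t λ y o → h y (≤-trans o (m≤m+n _ _)))
                (⟨⟩*-cong-vars ts λ y o → h y (≤-trans o (m≤n+m _ _)))

  fun-injective : ∀ {f} {ts us : Vec (Term ar) (ar f)} → fun f ts ≡ fun f us → ts ≡ us
  fun-injective refl = refl

  mutual
    ⟨⟩-injective-vars : ∀ t {σ τ : Subst} → t ⟨ σ ⟩ ≡ t ⟨ τ ⟩ →
                        ∀ y → 1 ≤ occ y t → σ y ≡ τ y
    ⟨⟩-injective-vars (var x) eq y o with y ≟ x
    ... | yes refl = eq
    ⟨⟩-injective-vars (var x) eq y () | no _
    ⟨⟩-injective-vars (fun f ts) eq = ⟨⟩*-injective-vars ts (fun-injective eq)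

    ⟨⟩*-injective-vars : ∀ {n} (ts : Vec (Term ar) n) {σ τ : Subst} →
                         ts ⟨ σ ⟩* ≡ ts ⟨ τ ⟩* → ∀ y → 1 ≤ occs y ts → σ y ≡ τ y
    ⟨⟩*-injective-vars (t ∷ ts) eq y o with occ y t in e
    ... | zero  = ⟨⟩*-injective-vars ts (∷-injectiveʳ eq) y o
    ... | suc _ = ⟨⟩-injective-vars t (∷-injectiveˡ eq) y (≡suc⇒1≤ e)

  ⟨⟩-[↦]-fresh : ∀ t {σ x u} → occ x t ≡ 0 → t ⟨ σ ⟩ ≡ t ⟨ σ [ x ↦ u ] ⟩
  ⟨⟩-[↦]-fresh t {σ} {x} {u} fresh = ⟨⟩-cong-vars t agree
    where
    agree : ∀ y → 1 ≤ occ y t → σ y ≡ (σ [ x ↦ u ]) y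
    agree y o with x ≟ y
    ... | yes refl = ⊥-elim (1+n≰n (subst (1 ≤_) fresh o))
    ... | no _     = refl

  ⟨⟩*-[↦]-fresh : ∀ {n} (ts : Vec (Term ar) n) {σ x u} → occs x ts ≡ 0 →
                  ts ⟨ σ ⟩* ≡ ts ⟨ σ [ x ↦ u ] ⟩*
  ⟨⟩*-[↦]-fresh ts {σ} {x} {u} fresh = ⟨⟩*-cong-vars ts agree
    where
    agree : ∀ y → 1 ≤ occs y ts → σ y ≡ (σ [ x ↦ u ]) y
    agree y o with x ≟ y
    ... | yes refl = ⊥-elim (1+n≰n (subst (1 ≤_) fresh o))
    ... | no _     = refl

  mutual
    ⊑-⟨⟩-var : ∀ t {σ} x → 1 ≤ occ x t → σ x ⊑ t ⟨ σ ⟩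
    ⊑-⟨⟩-var (var y) x o with x ≟ y
    ... | yes refl = here
    ⊑-⟨⟩-var (var y) x () | no _
    ⊑-⟨⟩-var (fun f ts) x o = there (⊑ᵥ-⟨⟩*-var ts x o)

    ⊑ᵥ-⟨⟩*-var : ∀ {n} (ts : Vec (Term ar) n) {σ} x → 1 ≤ occs x ts → σ x ⊑ᵥ ts ⟨ σ ⟩*
    ⊑ᵥ-⟨⟩*-var (t ∷ ts) x o with occ x t in e
    ... | zero  = tail (⊑ᵥ-⟨⟩*-var ts x o)
    ... | suc _ = head (⊑-⟨⟩-var t x (≡suc⇒1≤ e))

  mutual
    ⊑-⟨⟩-split : ∀ r {σ g} {us : Vec (Term ar) (ar g)} → fun g us ⊑ r ⟨ σ ⟩ →
      (Σ (Vec (Term ar) (ar g)) λ vs → fun g vs ⊑ r × us ≡ vs ⟨ σ ⟩*)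
      ⊎ (Σ ℕ λ x → 1 ≤ occ x r × fun g us ⊑ σ x)
    ⊑-⟨⟩-split (var x)    p = inj₂ (x , 1≤occ-var-self x , p)
    ⊑-⟨⟩-split (fun f rs) here = inj₁ (rs , here , refl)
    ⊑-⟨⟩-split (fun f rs) (there p) with ⊑ᵥ-⟨⟩*-split rs p
    ... | inj₁ (vs , q , e) = inj₁ (vs , there q , e)
    ... | inj₂ (x , o , q)  = inj₂ (x , o , q)

    ⊑ᵥ-⟨⟩*-split : ∀ {n} (rs : Vec (Term ar) n) {σ g} {us : Vec (Term ar) (ar g)} →
      fun g us ⊑ᵥ rs ⟨ σ ⟩* →
      (Σ (Vec (Term ar) (ar g)) λ vs → fun g vs ⊑ᵥ rs × us ≡ vs ⟨ σ ⟩*)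
      ⊎ (Σ ℕ λ x → 1 ≤ occs x rs × fun g us ⊑ σ x)
    ⊑ᵥ-⟨⟩*-split (r ∷ rs) (head p) with ⊑-⟨⟩-split r p
    ... | inj₁ (vs , q , e) = inj₁ (vs , head q , e)
    ... | inj₂ (x , o , q)  = inj₂ (x , ≤-trans o (m≤m+n _ _) , q)
    ⊑ᵥ-⟨⟩*-split (r ∷ rs) (tail p) with ⊑ᵥ-⟨⟩*-split rs p
    ... | inj₁ (vs , q , e) = inj₁ (vs , tail q , e)
    ... | inj₂ (x , o , q)  = inj₂ (x , ≤-trans o (m≤n+m _ _) , q)

module Rewriting {F : Set} {ar : F → ℕ} (R : TRS {ar = ar}) where

  open Terms {F} {ar}

  infix 4 _⟶_ _⟶ᵥ_
  data _⟶_ : Term ar → Term ar → Set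
  data _⟶ᵥ_ : ∀ {n} → Vec (Term ar) n → Vec (Term ar) n → Set
  data _⟶_ where
    root : ∀ {ℓ r} (σ : Subst) → R ℓ r → ℓ ⟨ σ ⟩ ⟶ r ⟨ σ ⟩
    cong : ∀ {f} {ts us : Vec (Term ar) (ar f)} → ts ⟶ᵥ us → fun f ts ⟶ fun f us
  data _⟶ᵥ_ where
    head : ∀ {n t u} {ts : Vec (Term ar) n} → t ⟶ u → t ∷ ts ⟶ᵥ u ∷ ts
    tail : ∀ {n t} {ts us : Vec (Term ar) n} → ts ⟶ᵥ us → t ∷ ts ⟶ᵥ t ∷ us

  mutual
    ⟶⇒Step : ∀ {t u} → t ⟶ u → Step R t u
    ⟶⇒Step (root σ ρ) = root σ ρ
    ⟶⇒Step (cong s) with ⟶ᵥ⇒Step-lookup s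
    ... | i , _ , s′ , refl = cong i s′

    ⟶ᵥ⇒Step-lookup : ∀ {n} {ts us : Vec (Term ar) n} → ts ⟶ᵥ us →
      Σ (Fin n) λ i → Σ (Term ar) λ u → Step R (lookup ts i) u × us ≡ ts [ i ]≔ u
    ⟶ᵥ⇒Step-lookup (head s) = zero , _ , ⟶⇒Step s , refl
    ⟶ᵥ⇒Step-lookup (tail s) with ⟶ᵥ⇒Step-lookup s
    ... | i , u , s′ , e = suc i , u , s′ , ap (_ ∷_) e

  lookup-⟶⇒⟶ᵥ : ∀ {n} {ts : Vec (Term ar) n} {u} i → lookup ts i ⟶ u → ts ⟶ᵥ ts [ i ]≔ u
  lookup-⟶⇒⟶ᵥ {ts = _ ∷ _} zero    s = head s
  lookup-⟶⇒⟶ᵥ {ts = _ ∷ _} (suc i) s = tail (lookup-⟶⇒⟶ᵥ i s)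

  Step⇒⟶ : ∀ {t u} → Step R t u → t ⟶ u
  Step⇒⟶ (root σ ρ) = root σ ρ
  Step⇒⟶ (cong i s) = cong (lookup-⟶⇒⟶ᵥ i (Step⇒⟶ s))

  mutual
    ⟶⇒redex : WellFormed R → ∀ {t u} → t ⟶ u →
      Σ F λ h → Σ (Vec (Term ar) (ar h)) λ hs → fun h hs ⊑ t × Defined R h
    ⟶⇒redex wf (root {ℓ} {r} σ ρ) with wf ℓ r ρ
    ... | (h , hs , refl) , _ = h , hs ⟨ σ ⟩* , here , hs , r , ρ
    ⟶⇒redex wf (cong s) with ⟶ᵥ⇒redex wf s
    ... | h , hs , p , d = h , hs , there p , d

    ⟶ᵥ⇒redex : WellFormed R → ∀ {n} {ts us : Vec (Term ar) n} → ts ⟶ᵥ us →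
      Σ F λ h → Σ (Vec (Term ar) (ar h)) λ hs → fun h hs ⊑ᵥ ts × Defined R h
    ⟶ᵥ⇒redex wf (head s) with ⟶⇒redex wf s
    ... | h , hs , p , d = h , hs , head p , d
    ⟶ᵥ⇒redex wf (tail s) with ⟶ᵥ⇒redex wf s
    ... | h , hs , p , d = h , hs , tail p , d

  mutual
    ⟶-⟨⟩-linear-var : ∀ r {σ x u} → occ x r ≡ 1 → σ x ⟶ u →
                      r ⟨ σ ⟩ ⟶ r ⟨ σ [ x ↦ u ] ⟩
    ⟶-⟨⟩-linear-var (var y) {σ} {x} e s with x ≟ y
    ... | yes refl = s
    ⟶-⟨⟩-linear-var (var y) () s | no _
    ⟶-⟨⟩-linear-var (fun f rs) e s = cong (⟶ᵥ-⟨⟩*-linear-var rs e s)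

    ⟶ᵥ-⟨⟩*-linear-var : ∀ {n} (rs : Vec (Term ar) n) {σ x u} → occs x rs ≡ 1 → σ x ⟶ u →
                        rs ⟨ σ ⟩* ⟶ᵥ rs ⟨ σ [ x ↦ u ] ⟩*
    ⟶ᵥ-⟨⟩*-linear-var (r ∷ rs) {σ} {x} {u} e s with occ x r in eʳ
    ... | zero =
      subst (λ r′ → r ⟨ σ ⟩ ∷ rs ⟨ σ ⟩* ⟶ᵥ r′ ∷ rs ⟨ σ [ x ↦ u ] ⟩*)
            (⟨⟩-[↦]-fresh r eʳ) (tail (⟶ᵥ-⟨⟩*-linear-var rs e s))
    ... | suc zero =
      subst (λ rs′ → r ⟨ σ ⟩ ∷ rs ⟨ σ ⟩* ⟶ᵥ r ⟨ σ [ x ↦ u ] ⟩ ∷ rs′)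
            (⟨⟩*-[↦]-fresh rs (suc-injective e)) (head (⟶-⟨⟩-linear-var r eʳ s))
    ⟶ᵥ-⟨⟩*-linear-var (r ∷ rs) () s | suc (suc _)

module Guarded {F : Set} {ar : F → ℕ} (R : TRS {ar = ar}) (Σ' : F → Set) where

  open Terms {F} {ar}

  DefinedFree : ∀ {n} → Vec (Term ar) n → Set
  DefinedFree us = ∀ h (hs : Vec (Term ar) (ar h)) → fun h hs ⊑ᵥ us → ¬ Defined R h

  Guarded : Term ar → Set
  Guarded t = ∀ g (us : Vec (Term ar) (ar g)) → fun g us ⊑ t → Σ' g → DefinedFree us

  Guardedᵥ : ∀ {n} → Vec (Term ar) n → Set
  Guardedᵥ ts = ∀ g (us : Vec (Term ar) (ar g)) → fun g us ⊑ᵥ ts → Σ' g → DefinedFree us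

  Guarded-fun : ∀ {f} {ts : Vec (Term ar) (ar f)} → Guarded (fun f ts) → Guardedᵥ ts
  Guarded-fun G g us p = G g us (there p)

  Guardedᵥ-head : ∀ {n t} {ts : Vec (Term ar) n} → Guardedᵥ (t ∷ ts) → Guarded t
  Guardedᵥ-head G g us p = G g us (head p)

  Guardedᵥ-tail : ∀ {n t} {ts : Vec (Term ar) n} → Guardedᵥ (t ∷ ts) → Guardedᵥ ts
  Guardedᵥ-tail G g us p = G g us (tail p)

  basic⇒guarded : ∀ t → Basic R t → Guarded t
  basic⇒guarded _ (f , ts , refl , _ , args-free) g us here _ h hs p
    with ⊑ᵥ⇒⊴-lookup p
  ... | i , q = args-free i h (hs , q)
  basic⇒guarded _ (f , ts , refl , _ , args-free) g us (there p) _ h hs q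
    with ⊑ᵥ⇒⊴-lookup (⊑-⊑ᵥ-trans (there q) p)
  ... | i , q′ = args-free i h (hs , q′)

module Diamond {F : Set} {ar : F → ℕ} (R : TRS {ar = ar}) (Σ' : F → Set)
  (wf : WellFormed R) (orth : Orthogonal R)
  (shape : ∀ ℓ r → R ℓ r → ShapeI Σ' ℓ r ⊎ ShapeII R Σ' ℓ r) where

  open Terms {F} {ar}
  open Rewriting R
  open Guarded R Σ'

  rhs-vars⊆lhs-vars : ∀ {ℓ r} → R ℓ r → ∀ x → 1 ≤ occ x r → 1 ≤ occ x ℓ
  rhs-vars⊆lhs-vars ρ = proj₂ (wf _ _ ρ)

  root-preserves-guarded : ∀ {ℓ r} σ → R ℓ r → Guarded (ℓ ⟨ σ ⟩) → Guarded (r ⟨ σ ⟩)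
  root-preserves-guarded {ℓ} {r} σ ρ G g us p g∈Σ' with ⊑-⟨⟩-split r p | shape ℓ r ρ
  ... | inj₂ (x , x∈r , q) | _ =
    G g us (⊑-trans q (⊑-⟨⟩-var ℓ x (rhs-vars⊆lhs-vars ρ x x∈r))) g∈Σ'
  ... | inj₁ (vs , q , _) | inj₁ (_ , _ , r∌Σ') = ⊥-elim (r∌Σ' (g , g∈Σ' , vs , ⊑⇒⊴ q))
  ... | inj₁ (vs , q , refl) | inj₂ ((f , ls , refl , f∈Σ') , rhs-args-free) = free
    where
    free : DefinedFree (vs ⟨ σ ⟩*)
    free h hs p′ with ⊑ᵥ-⟨⟩*-split vs p′
    ... | inj₁ (ws , q′ , _) with ⊑ᵥ⇒⊴-lookup q′
    ...   | i , q″ = rhs-args-free g vs (⊑⇒⊴ q) g∈Σ' i h (ws , q″)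
    free h hs p′ | inj₂ (x , x∈vs , q′) =
      G f (ls ⟨ σ ⟩*) here f∈Σ' h hs
        (⊑-⊑ᵥ-trans q′ (⊑ᵥ-⟨⟩*-var ls x (rhs-vars⊆lhs-vars ρ x (occ-⊑ x q x∈vs))))

  mutual
    ⟶-preserves-guarded : ∀ {t u} → Guarded t → t ⟶ u → Guarded u
    ⟶-preserves-guarded G (root σ ρ) = root-preserves-guarded σ ρ G
    ⟶-preserves-guarded G (cong {f} {ts} s) g us here g∈Σ' with ⟶ᵥ⇒redex wf s
    ... | h , hs , p , d = ⊥-elim (G f ts here g∈Σ' h hs p d)
    ⟶-preserves-guarded G (cong s) g us (there p) =
      ⟶ᵥ-preserves-guarded (Guarded-fun G) s g us p

    ⟶ᵥ-preserves-guarded : ∀ {n} {ts us : Vec (Term ar) n} →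
                           Guardedᵥ ts → ts ⟶ᵥ us → Guardedᵥ us
    ⟶ᵥ-preserves-guarded G (head s) g vs (head p) =
      ⟶-preserves-guarded (Guardedᵥ-head G) s g vs p
    ⟶ᵥ-preserves-guarded G (head s) g vs (tail p) = G g vs (tail p)
    ⟶ᵥ-preserves-guarded G (tail s) g vs (head p) = G g vs (head p)
    ⟶ᵥ-preserves-guarded G (tail s) g vs (tail p) =
      ⟶ᵥ-preserves-guarded (Guardedᵥ-tail G) s g vs p

  Unmatched : Term ar → Subst → Set
  Unmatched s σ = ∀ s′ → s′ ⊑ s → IsFun s′ → ∀ ℓ r τ → R ℓ r → ¬ s′ ⟨ σ ⟩ ≡ ℓ ⟨ τ ⟩

  Unmatchedᵥ : ∀ {n} → Vec (Term ar) n → Subst → Set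
  Unmatchedᵥ ss σ = ∀ s′ → s′ ⊑ᵥ ss → IsFun s′ → ∀ ℓ r τ → R ℓ r → ¬ s′ ⟨ σ ⟩ ≡ ℓ ⟨ τ ⟩

  mutual
    ⟶-inside-var : ∀ s {σ t u} → (∀ x → occ x s ≤ 1) → Unmatched s σ → t ⟶ u →
      t ≡ s ⟨ σ ⟩ →
      Σ ℕ λ x → Σ (Term ar) λ u′ → 1 ≤ occ x s × σ x ⟶ u′ × u ≡ s ⟨ σ [ x ↦ u′ ] ⟩
    ⟶-inside-var (var x) {σ} _ _ s refl =
      x , _ , 1≤occ-var-self x , s , sym ([↦]-self σ x _)
    ⟶-inside-var (fun g ss) _ unm (root τ ρ) eq =
      ⊥-elim (unm (fun g ss) here (g , ss , refl) _ _ τ ρ (sym eq))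
    ⟶-inside-var (fun g ss) lin unm (cong s) refl
      with ⟶ᵥ-inside-var ss lin (λ s′ p → unm s′ (there p)) s
    ... | x , u′ , x∈ss , s′ , refl = x , u′ , x∈ss , s′ , refl

    ⟶ᵥ-inside-var : ∀ {n} (ss : Vec (Term ar) n) {σ us} →
      (∀ x → occs x ss ≤ 1) → Unmatchedᵥ ss σ → ss ⟨ σ ⟩* ⟶ᵥ us →
      Σ ℕ λ x → Σ (Term ar) λ u′ → 1 ≤ occs x ss × σ x ⟶ u′ × us ≡ ss ⟨ σ [ x ↦ u′ ] ⟩*
    ⟶ᵥ-inside-var (s ∷ ss) lin unm (head st)
      with ⟶-inside-var s (λ x → ≤-trans (m≤m+n _ _) (lin x)) (λ s′ p → unm s′ (head p)) st refl
    ... | x , u′ , x∈s , st′ , e =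
      x , u′ , ≤-trans x∈s (m≤m+n _ _) , st′ ,
      cong₂ _∷_ e (⟨⟩*-[↦]-fresh ss (1≤m⇒m+n≤1⇒n≡0 x∈s (lin x)))
    ⟶ᵥ-inside-var (s ∷ ss) lin unm (tail st)
      with ⟶ᵥ-inside-var ss (λ x → ≤-trans (m≤n+m _ _) (lin x)) (λ s′ p → unm s′ (tail p)) st
    ... | x , u′ , x∈ss , st′ , e =
      x , u′ , ≤-trans x∈ss (m≤n+m _ _) , st′ ,
      cong₂ _∷_ (⟨⟩-[↦]-fresh s (1≤n⇒m+n≤1⇒m≡0 x∈ss (lin x))) e

  Joinable : Term ar → Term ar → Set
  Joinable b c = b ≡ c ⊎ ∃ λ d → b ⟶ d × c ⟶ d

  Joinableᵥ : ∀ {n} → Vec (Term ar) n → Vec (Term ar) n → Set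
  Joinableᵥ bs cs = bs ≡ cs ⊎ ∃ λ ds → bs ⟶ᵥ ds × cs ⟶ᵥ ds

  Joinable-sym : ∀ {b c} → Joinable b c → Joinable c b
  Joinable-sym (inj₁ b≡c)            = inj₁ (sym b≡c)
  Joinable-sym (inj₂ (d , b⟶d , c⟶d)) = inj₂ (d , c⟶d , b⟶d)

  -- In shape (ii) the step is impossible: the arguments of a guarded
  -- Σ'-rooted redex are defined-free, so they contain no redex.
  rhs-step : ∀ {f ls r} → R (fun f ls) r → ∀ σ → Guarded (fun f (ls ⟨ σ ⟩*)) →
             ∀ x {u} → 1 ≤ occs x ls → σ x ⟶ u → r ⟨ σ ⟩ ⟶ r ⟨ σ [ x ↦ u ] ⟩
  rhs-step {ls = ls} {r} ρ σ G x x∈ls s with shape _ _ ρ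
  ... | inj₁ (preserving , _) = ⟶-⟨⟩-linear-var r (preserving x x∈ls) s
  ... | inj₂ ((_ , _ , refl , f∈Σ') , _) with ⟶⇒redex wf s
  ...   | h , hs , p , d =
    ⊥-elim (G _ _ here f∈Σ' h hs (⊑-⊑ᵥ-trans p (⊑ᵥ-⟨⟩*-var ls x x∈ls)) d)

  root-diamond-fun : ∀ {f ls r} → R (fun f ls) r → ∀ σ {t u} → Guarded t → t ⟶ u →
                 t ≡ fun f (ls ⟨ σ ⟩*) → Joinable (r ⟨ σ ⟩) u
  root-diamond-fun {f} {ls} {r} ρ σ G (root τ ρ′) eq
    with proj₁ (proj₂ orth) _ _ _ _ τ σ ρ′ ρ eq
  ... | refl , refl = inj₁ (⟨⟩-cong-vars r λ y y∈r →
          sym (⟨⟩-injective-vars (fun f ls) eq y (rhs-vars⊆lhs-vars ρ y y∈r)))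
  root-diamond-fun {ls = ls} ρ σ G (cong s) refl
    with ⟶ᵥ-inside-var ls (proj₁ orth _ _ ρ) unmatched s
    where
    unmatched : Unmatchedᵥ ls σ
    unmatched s′ p isFun ℓ r τ ρ′ =
      proj₂ (proj₂ orth) _ _ ℓ r s′ σ τ ρ ρ′ (⊑ᵥ⇒◁ p) isFun
  ... | x , u , x∈ls , s′ , refl =
    inj₂ (_ , rhs-step ρ σ G x x∈ls s′ , root (σ [ x ↦ u ]) ρ)

  root-diamond : ∀ {ℓ r} → R ℓ r → ∀ σ {u} → Guarded (ℓ ⟨ σ ⟩) → ℓ ⟨ σ ⟩ ⟶ u →
                  Joinable (r ⟨ σ ⟩) u
  root-diamond {ℓ} {r} ρ σ G s with proj₁ (wf ℓ r ρ)
  ... | _ , _ , refl = root-diamond-fun ρ σ G s refl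

  mutual
    diamond : ∀ {t b c} → Guarded t → t ⟶ b → t ⟶ c → Joinable b c
    diamond G (root σ ρ) s = root-diamond ρ σ G s
    diamond G (cong s) s′ = cong-diamond G s s′ refl

    cong-diamond : ∀ {f} {ts bs : Vec (Term ar) (ar f)} {t c} → Guarded t →
                   ts ⟶ᵥ bs → t ⟶ c → t ≡ fun f ts → Joinable (fun f bs) c
    cong-diamond G s (root τ ρ) eq =
      Joinable-sym (root-diamond ρ τ G (subst (_⟶ _) (sym eq) (cong s)))
    cong-diamond G s (cong s′) refl with diamondᵥ (Guarded-fun G) s s′
    ... | inj₁ refl                  = inj₁ refl
    ... | inj₂ (ds , bs⟶ds , cs⟶ds) = inj₂ (fun _ ds , cong bs⟶ds , cong cs⟶ds)

    diamondᵥ : ∀ {n} {ts bs cs : Vec (Term ar) n} → Guardedᵥ ts →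
               ts ⟶ᵥ bs → ts ⟶ᵥ cs → Joinableᵥ bs cs
    diamondᵥ G (head s) (head s′) with diamond (Guardedᵥ-head G) s s′
    ... | inj₁ refl            = inj₁ refl
    ... | inj₂ (_ , b⟶d , c⟶d) = inj₂ (_ , head b⟶d , head c⟶d)
    diamondᵥ G (head s) (tail s′) = inj₂ (_ , tail s′ , head s)
    diamondᵥ G (tail s) (head s′) = inj₂ (_ , head s′ , tail s)
    diamondᵥ G (tail s) (tail s′) with diamondᵥ (Guardedᵥ-tail G) s s′
    ... | inj₁ refl            = inj₁ refl
    ... | inj₂ (_ , b⟶d , c⟶d) = inj₂ (_ , tail b⟶d , tail c⟶d)

  open RandomDescent _⟶_ Guarded ⟶-preserves-guarded diamond public

  Steps⇒⟶[] : ∀ {n t u} → Steps R n t u → t ⟶[ n ] u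
  Steps⇒⟶[] done       = done
  Steps⇒⟶[] (step s r) = step (Step⇒⟶ s) (Steps⇒⟶[] r)

  NormalForm⇒Normal : ∀ {t} → NormalForm R t → Normal t
  NormalForm⇒Normal nf u s = nf u (⟶⇒Step s)

theorem3 : {F : Set} (ar : F → ℕ) (R : Term ar → Term ar → Set) (Σ' : F → Set) →
    WellFormed R → Orthogonal R →
    (∀ ℓ r → R ℓ r → ShapeI Σ' ℓ r ⊎ ShapeII R Σ' ℓ r) →
    ∀ (t : Term ar) → Basic R t →
    ∀ {m n : ℕ} {u v : Term ar} →
    Steps R m t u → NormalForm R u → Steps R n t v → NormalForm R v → m ≡ n
theorem3 ar R Σ' wf orth shape t basic t⟶u u-normal t⟶v v-normal =
  normal-forms-have-equal-distance (basic⇒guarded t basic)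
    (Steps⇒⟶[] t⟶u) (NormalForm⇒Normal u-normal)
    (Steps⇒⟶[] t⟶v) (NormalForm⇒Normal v-normal)
  where
  open Guarded R Σ'
  open Diamond R Σ' wf orth shape
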